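{- Let $a$ and $b$ be positive integers and define $p_{a,b}\colon\mathbb{N}^2\to\mathbb{N}$ by \[ p_{a,b}(x,y)=\begin{cases} y\bigl\lfloor\sqrt[b]{y}\,\bigr\rfloor^a+x &\text{if } \bigl\lfloor\sqrt[b]{y}\,\bigr\rfloor>\bigl\lfloor\sqrt[a]{x}\,\bigr\rfloor,\\ x\Bigl(\bigl\lfloor\sqrt[a]{x}\,\bigr\rfloor+1\Bigr)^{b}+y &\text{otherwise}. \end{cases} \] Then $p_{a,b}$ is a bijection from $\mathbb{N}^2$ to $\mathbb{N}$, and its inverse is given, for each $z\in\mathbb{N}$, by \[ p_{a,b}^{ -1}(z)=\begin{cases} \Bigl(z\bmod m^a,\;\bigl\lfloor z/m^a\bigr\rfloor\Bigr) &\text{if } z<m^a(m+1)^b,\\ \Bigl(\bigl\lfloor z/(m+1)^b\bigr\rfloor,\;z\bmod (m+1)^b\Bigr) &\text{otherwise}, \end{cases} \] where $m=\bigl\lfloor z^{1/(a+b)}\bigr\rfloor$.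
   Context: $\mathbb{N}$ denotes the set of non-negative integers. -}

module Defs where

open import Data.Nat using (ℕ; zero; suc; _+_; _*_; _^_; _<_; _≤?_; _<?_; NonZero)
open import Data.Nat.DivMod using (_/_; _%_)
open import Data.Nat.Properties using (m^n≢0)
open import Data.Product using (_×_; _,_)
open import Relation.Nullary using (yes; no)

rootSearch : ℕ → ℕ → ℕ → ℕ
rootSearch k n zero = zero
rootSearch k n (suc r) with suc r ^ k ≤? n
... | yes _ = suc r
... | no  _ = rootSearch k n r

-- Floor of the k-th root of n, ⌊ n^(1/k) ⌋ (meaningful for k ≥ 1,
-- where the root is ≤ n, so searching r ∈ {0,…,n} suffices).
iroot : ℕ → ℕ → ℕ
iroot k n = rootSearch k n n

pair : ℕ → ℕ → ℕ → ℕ → ℕ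
pair a b x y with iroot a x <? iroot b y
... | yes _ = y * iroot b y ^ a + x
... | no  _ = x * (iroot a x + 1) ^ b + y

-- (z mod d , z div d); the case d = 0 never arises in `unpair` below,
-- since there z < d * e forces d ≠ 0.
divModPair : ℕ → ℕ → ℕ × ℕ
divModPair z zero = (z , zero)
divModPair z (suc d) = (z % suc d , z / suc d)

unpair : ℕ → ℕ → ℕ → ℕ × ℕ
unpair a b z with iroot (a + b) z
... | m with z <? m ^ a * (m + 1) ^ b
...   | yes _ = divModPair z (m ^ a)
...   | no  _ = (z / (suc m ^ b)) {{m^n≢0 (suc m) b}} , (z % (suc m ^ b)) {{m^n≢0 (suc m) b}}

module Submission where

-- Write m = ⌊z^{1/(a+b)}⌋, so that z lies in the shell [m^(a+b), (m+1)^(a+b)).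
-- The threshold t = m^a (m+1)^b splits this shell into two blocks:
--   * the lower block [m^b·m^a, (m+1)^b·m^a) consists of the numbers y·m^a + x
--     with x < m^a and m^b ≤ y < (m+1)^b, i.e. ⌊x^{1/a}⌋ < m = ⌊y^{1/b}⌋;
--   * the upper block [m^a·(m+1)^b, (m+1)^a·(m+1)^b) consists of the numbers
--     x·(m+1)^b + y with y < (m+1)^b and m^a ≤ x < (m+1)^a, i.e.
--     ⌊y^{1/b}⌋ ≤ m = ⌊x^{1/a}⌋.
-- These are exactly the two branches of p_{a,b}, and in each block the pair is
-- recovered from z by division with remainder.  The file first develops integer
-- roots (characterised by the shell containing n) and the range behaviour of
-- "digit pairs" q·d + r under division, then unfolds the case splits of `pair`
-- and `unpair`, proves both composites are the identity block by block, and
-- finally obtains bijectivity from the two-sided inverse.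

open import Defs
open import Data.Nat using (ℕ; zero; suc; _+_; _*_; _^_; _≤_; _<_; _≤?_; _<?_; NonZero; >-nonZero; z≤n; s≤s)
open import Data.Product using (_×_; _,_; proj₁; proj₂)
open import Function.Definitions using (Bijective)
open import Data.Nat.Properties
open import Data.Nat.DivMod
open import Data.Empty using (⊥-elim)
open import Data.Sum using (inj₁; inj₂)
open import Function.Consequences using (inverseᵇ⇒bijective)
open import Function.Consequences.Propositional
  using (strictlyInverseˡ⇒inverseˡ; strictlyInverseʳ⇒inverseʳ)
open import Relation.Nullary using (¬_; Dec; yes; no)
open import Relation.Binary.Definitions using (tri<; tri≈; tri>)
open import Relation.Binary.PropositionalEquality using (_≡_; refl; sym; trans; cong; cong₂; subst; module ≡-Reasoning)

Shell : ℕ → ℕ → ℕ → Set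
Shell k r n = r ^ k ≤ n × n < suc r ^ k

base≤pow : ∀ m k → 1 ≤ k → m ≤ m ^ k
base≤pow zero    k       _ = z≤n
base≤pow (suc m) (suc k) _ = m≤m*n (suc m) (suc m ^ k) {{m^n≢0 (suc m) k}}

rootSearch-sound : ∀ k n B → 1 ≤ k → rootSearch k n B ^ k ≤ n
rootSearch-sound (suc k) n zero    _  = z≤n
rootSearch-sound k       n (suc r) hk with suc r ^ k ≤? n
... | yes p = p
... | no  _ = rootSearch-sound k n r hk

rootSearch-maximal : ∀ k n B t → rootSearch k n B < t → t ≤ B → ¬ (t ^ k ≤ n)
rootSearch-maximal k n zero    t lt t≤B = ⊥-elim (<⇒≱ lt t≤B)
rootSearch-maximal k n (suc r) t lt t≤B with suc r ^ k ≤? n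
... | yes _ = ⊥-elim (<⇒≱ lt t≤B)
... | no  p with m≤n⇒m<n∨m≡n t≤B
...   | inj₁ t<1+r = rootSearch-maximal k n r t lt (≤-pred t<1+r)
...   | inj₂ refl  = p

iroot-shell : ∀ k n → 1 ≤ k → Shell k (iroot k n) n
iroot-shell k n hk = rootSearch-sound k n n hk , upper
  where
  upper : n < suc (iroot k n) ^ k
  upper with suc (iroot k n) ≤? n
  ... | yes r<n = ≰⇒> (rootSearch-maximal k n n (suc (iroot k n)) ≤-refl r<n)
  ... | no  n≤r = <-≤-trans (≰⇒> n≤r) (base≤pow (suc (iroot k n)) k hk)

shell⇒iroot : ∀ k n r → 1 ≤ k → Shell k r n → iroot k n ≡ r
shell⇒iroot k n r hk (lo , hi) with <-cmp (iroot k n) r | iroot-shell k n hk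
... | tri< s<r _ _ | _ , hi′ = ⊥-elim (<⇒≱ hi′ (≤-trans (^-monoˡ-≤ k s<r) lo))
... | tri≈ _ s≡r _ | _       = s≡r
... | tri> _ _ r<s | lo′ , _ = ⊥-elim (<⇒≱ hi (≤-trans (^-monoˡ-≤ k r<s) lo′))

iroot<⇒<pow : ∀ k n s → 1 ≤ k → iroot k n < s → n < s ^ k
iroot<⇒<pow k n s hk r<s = <-≤-trans (proj₂ (iroot-shell k n hk)) (^-monoˡ-≤ k r<s)

<pow⇒iroot< : ∀ k n s → 1 ≤ k → n < s ^ k → iroot k n < s
<pow⇒iroot< k n s hk n<s^k =
  ≰⇒> (λ s≤r → <⇒≱ n<s^k (≤-trans (^-monoˡ-≤ k s≤r) (proj₁ (iroot-shell k n hk))))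

%-digits : ∀ q r d .{{_ : NonZero d}} → r < d → (q * d + r) % d ≡ r
%-digits q r d r<d = begin
  (q * d + r) % d ≡⟨ cong (_% d) (+-comm (q * d) r) ⟩
  (r + q * d) % d ≡⟨ [m+kn]%n≡m%n r q d ⟩
  r % d           ≡⟨ m<n⇒m%n≡m r<d ⟩
  r               ∎
  where open ≡-Reasoning

/-digits : ∀ q r d .{{_ : NonZero d}} → r < d → (q * d + r) / d ≡ q
/-digits q r d r<d = begin
  (q * d + r) / d   ≡⟨ +-distrib-/ (q * d) r no-carry ⟩
  q * d / d + r / d ≡⟨ cong₂ _+_ (m*n/n≡m q d) (m<n⇒m/n≡0 r<d) ⟩
  q + 0             ≡⟨ +-identityʳ q ⟩
  q                 ∎
  where
  open ≡-Reasoning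
  no-carry : q * d % d + r % d < d
  no-carry = subst (_< d) (sym (cong₂ _+_ (m*n%n≡0 q d) (m<n⇒m%n≡m r<d))) r<d

digits-range : ∀ lo hi q r d → r < d → lo ≤ q → q < hi → lo * d ≤ q * d + r × q * d + r < hi * d
digits-range lo hi q r d r<d lo≤q q<hi =
  ≤-trans (*-monoˡ-≤ d lo≤q) (m≤m+n (q * d) r) ,
  (begin-strict
    q * d + r   <⟨ +-monoʳ-< (q * d) r<d ⟩
    q * d + d   ≡⟨ +-comm (q * d) d ⟩
    suc q * d   ≤⟨ *-monoˡ-≤ d q<hi ⟩
    hi * d      ∎)
  where open ≤-Reasoning

quotient-range : ∀ lo hi z d .{{_ : NonZero d}} → lo * d ≤ z → z < hi * d → lo ≤ z / d × z / d < hi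
quotient-range lo hi z d lo*d≤z z<hi*d =
  subst (_≤ z / d) (m*n/n≡m lo d) (/-monoˡ-≤ d lo*d≤z) , m<n*o⇒m/o<n z<hi*d

pair-below : ∀ a b x y → iroot a x < iroot b y → pair a b x y ≡ y * iroot b y ^ a + x
pair-below a b x y lt with iroot a x <? iroot b y
... | yes _ = refl
... | no  p = ⊥-elim (p lt)

pair-above : ∀ a b x y → ¬ (iroot a x < iroot b y) → pair a b x y ≡ x * suc (iroot a x) ^ b + y
pair-above a b x y nlt with iroot a x <? iroot b y
... | yes p = ⊥-elim (nlt p)
... | no  _ = cong (λ t → x * t ^ b + y) (+-comm (iroot a x) 1)

threshold : ℕ → ℕ → ℕ → ℕ
threshold a b m = m ^ a * suc m ^ b

threshold-zero : ∀ a b → 1 ≤ a → threshold a b 0 ≡ 0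
threshold-zero (suc a) b _ = refl

lower-start : ∀ a b m → m ^ b * m ^ a ≡ m ^ (a + b)
lower-start a b m = trans (*-comm (m ^ b) (m ^ a)) (sym (^-distribˡ-+-* m a b))

threshold≤shell-end : ∀ a b m → threshold a b m ≤ suc m ^ (a + b)
threshold≤shell-end a b m = subst (threshold a b m ≤_) (sym (^-distribˡ-+-* (suc m) a b))
  (*-monoˡ-≤ (suc m ^ b) (^-monoˡ-≤ a (n≤1+n m)))

shell-start≤threshold : ∀ a b m → m ^ (a + b) ≤ threshold a b m
shell-start≤threshold a b m = subst (_≤ threshold a b m) (sym (^-distribˡ-+-* m a b))
  (*-monoʳ-≤ (m ^ a) (^-monoˡ-≤ b (n≤1+n m)))

upper-end : ∀ a b m → suc m ^ a * suc m ^ b ≡ suc m ^ (a + b)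
upper-end a b m = sym (^-distribˡ-+-* (suc m) a b)

divModPair-nonZero : ∀ z d .{{_ : NonZero d}} → divModPair z d ≡ (z % d , z / d)
divModPair-nonZero z (suc d) = refl

unpair-below : ∀ a b z m .{{_ : NonZero m}} → iroot (a + b) z ≡ m → z < threshold a b m →
  unpair a b z ≡ ((z % m ^ a) {{m^n≢0 m a}} , (z / m ^ a) {{m^n≢0 m a}})
unpair-below a b z m refl lt with z <? iroot (a + b) z ^ a * (iroot (a + b) z + 1) ^ b
... | yes _ = divModPair-nonZero z (m ^ a) {{m^n≢0 m a}}
... | no  p = ⊥-elim (p (subst (λ t → z < m ^ a * t ^ b) (+-comm 1 m) lt))

unpair-above : ∀ a b z m → iroot (a + b) z ≡ m → ¬ (z < threshold a b m) →
  unpair a b z ≡ ((z / suc m ^ b) {{m^n≢0 (suc m) b}} , (z % suc m ^ b) {{m^n≢0 (suc m) b}})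
unpair-above a b z m refl nlt with z <? iroot (a + b) z ^ a * (iroot (a + b) z + 1) ^ b
... | yes p = ⊥-elim (nlt (subst (λ t → z < m ^ a * t ^ b) (+-comm m 1) p))
... | no  _ = refl

module Blocks (a b : ℕ) (ha : 1 ≤ a) (hb : 1 ≤ b) where

  hab : 1 ≤ a + b
  hab = ≤-trans ha (m≤m+n a b)

  shell-of : ∀ z m → iroot (a + b) z ≡ m → Shell (a + b) m z
  shell-of z m root-z = subst (λ r → Shell (a + b) r z) root-z (iroot-shell (a + b) z hab)

  unpair-lower : ∀ x y → iroot a x < iroot b y → unpair a b (y * iroot b y ^ a + x) ≡ (x , y)
  unpair-lower x y x<s = begin
    unpair a b z           ≡⟨ unpair-below a b z s root-z z<t ⟩
    (z % s ^ a , z / s ^ a) ≡⟨ cong₂ _,_ (%-digits y x (s ^ a) x<d) (/-digits y x (s ^ a) x<d) ⟩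
    (x , y)                ∎
    where
    open ≡-Reasoning
    s = iroot b y
    instance
      s≢0 : NonZero s
      s≢0 = >-nonZero (≤-<-trans z≤n x<s)
      d≢0 : NonZero (s ^ a)
      d≢0 = m^n≢0 s a
    z = y * s ^ a + x
    x<d : x < s ^ a
    x<d = iroot<⇒<pow a x s ha x<s
    bounds : s ^ b * s ^ a ≤ z × z < suc s ^ b * s ^ a
    bounds = digits-range _ _ y x (s ^ a) x<d (proj₁ (iroot-shell b y hb)) (proj₂ (iroot-shell b y hb))
    z<t : z < threshold a b s
    z<t = subst (z <_) (*-comm (suc s ^ b) (s ^ a)) (proj₂ bounds)
    root-z : iroot (a + b) z ≡ s
    root-z = shell⇒iroot (a + b) z s hab
      (subst (_≤ z) (lower-start a b s) (proj₁ bounds) , <-≤-trans z<t (threshold≤shell-end a b s))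

  unpair-upper : ∀ x y → ¬ (iroot a x < iroot b y) → unpair a b (x * suc (iroot a x) ^ b + y) ≡ (x , y)
  unpair-upper x y nlt = begin
    unpair a b z                       ≡⟨ unpair-above a b z r root-z (≤⇒≯ (proj₁ bounds)) ⟩
    (z / suc r ^ b , z % suc r ^ b)    ≡⟨ cong₂ _,_ (/-digits x y (suc r ^ b) y<d) (%-digits x y (suc r ^ b) y<d) ⟩
    (x , y)                            ∎
    where
    open ≡-Reasoning
    r = iroot a x
    instance
      d≢0 : NonZero (suc r ^ b)
      d≢0 = m^n≢0 (suc r) b
    z = x * suc r ^ b + y
    y<d : y < suc r ^ b
    y<d = iroot<⇒<pow b y (suc r) hb (s≤s (≮⇒≥ nlt))
    bounds : threshold a b r ≤ z × z < suc r ^ a * suc r ^ b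
    bounds = digits-range _ _ x y (suc r ^ b) y<d (proj₁ (iroot-shell a x ha)) (proj₂ (iroot-shell a x ha))
    root-z : iroot (a + b) z ≡ r
    root-z = shell⇒iroot (a + b) z r hab
      (≤-trans (shell-start≤threshold a b r) (proj₁ bounds) , subst (z <_) (upper-end a b r) (proj₂ bounds))

  unpair∘pair : ∀ x y → unpair a b (pair a b x y) ≡ (x , y)
  unpair∘pair x y = by-branch (iroot a x <? iroot b y)
    where
    by-branch : Dec (iroot a x < iroot b y) → unpair a b (pair a b x y) ≡ (x , y)
    by-branch (yes lt) = trans (cong (unpair a b) (pair-below a b x y lt)) (unpair-lower x y lt)
    by-branch (no nlt) = trans (cong (unpair a b) (pair-above a b x y nlt)) (unpair-upper x y nlt)

  P : ℕ × ℕ → ℕ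
  P (x , y) = pair a b x y

  pair-lower : ∀ z m → iroot (a + b) z ≡ m → z < threshold a b m → P (unpair a b z) ≡ z
  pair-lower z zero    _      z<t = ⊥-elim (n≮0 (subst (z <_) (threshold-zero a b ha) z<t))
  pair-lower z (suc m) root-z z<t = begin
    P (unpair a b z)           ≡⟨ cong P (unpair-below a b z (suc m) root-z z<t) ⟩
    pair a b x y               ≡⟨ pair-below a b x y (subst (iroot a x <_) (sym root-y) root-x<) ⟩
    y * iroot b y ^ a + x      ≡⟨ cong (λ t → y * t ^ a + x) root-y ⟩
    y * d + x                  ≡⟨ +-comm (y * d) x ⟩
    x + y * d                  ≡⟨ m≡m%n+[m/n]*n z d ⟨
    z                          ∎
    where
    open ≡-Reasoning
    d = suc m ^ a
    instance
      d≢0 : NonZero d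
      d≢0 = m^n≢0 (suc m) a
    x = z % d
    y = z / d
    root-y : iroot b y ≡ suc m
    root-y = shell⇒iroot b y (suc m) hb (quotient-range _ _ z d
      (subst (_≤ z) (sym (lower-start a b (suc m))) (proj₁ (shell-of z (suc m) root-z)))
      (subst (z <_) (*-comm d (suc (suc m) ^ b)) z<t))
    root-x< : iroot a x < suc m
    root-x< = <pow⇒iroot< a x (suc m) ha (m%n<n z d)

  pair-upper : ∀ z m → iroot (a + b) z ≡ m → ¬ (z < threshold a b m) → P (unpair a b z) ≡ z
  pair-upper z m root-z nlt = begin
    P (unpair a b z)           ≡⟨ cong P (unpair-above a b z m root-z nlt) ⟩
    pair a b x y               ≡⟨ pair-above a b x y (λ lt → <⇒≱ (subst (_< iroot b y) root-x lt) root-y≤) ⟩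
    x * suc (iroot a x) ^ b + y ≡⟨ cong (λ t → x * suc t ^ b + y) root-x ⟩
    x * d + y                  ≡⟨ +-comm (x * d) y ⟩
    y + x * d                  ≡⟨ m≡m%n+[m/n]*n z d ⟨
    z                          ∎
    where
    open ≡-Reasoning
    d = suc m ^ b
    instance
      d≢0 : NonZero d
      d≢0 = m^n≢0 (suc m) b
    x = z / d
    y = z % d
    root-x : iroot a x ≡ m
    root-x = shell⇒iroot a x m ha (quotient-range _ _ z d (≮⇒≥ nlt)
      (subst (z <_) (sym (upper-end a b m)) (proj₂ (shell-of z m root-z))))
    root-y≤ : iroot b y ≤ m
    root-y≤ = ≤-pred (<pow⇒iroot< b y (suc m) hb (m%n<n z d))

  pair∘unpair : ∀ z → P (unpair a b z) ≡ z
  pair∘unpair z with z <? threshold a b (iroot (a + b) z)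
  ... | yes lt = pair-lower z (iroot (a + b) z) refl lt
  ... | no nlt = pair-upper z (iroot (a + b) z) refl nlt

mainTheorem2 : (a b : ℕ) → 1 ≤ a → 1 ≤ b →
    Bijective _≡_ _≡_ (λ (xy : ℕ × ℕ) → pair a b (proj₁ xy) (proj₂ xy))
    × (∀ x y → unpair a b (pair a b x y) ≡ (x , y))
    × (∀ z → pair a b (proj₁ (unpair a b z)) (proj₂ (unpair a b z)) ≡ z)
mainTheorem2 a b ha hb = bijective , unpair∘pair , pair∘unpair
  where
  open Blocks a b ha hb
  bijective : Bijective _≡_ _≡_ P
  bijective = inverseᵇ⇒bijective {f⁻¹ = unpair a b} _≡_ refl sym trans
    ( strictlyInverseˡ⇒inverseˡ {f⁻¹ = unpair a b} P pair∘unpair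
    , strictlyInverseʳ⇒inverseʳ {f⁻¹ = unpair a b} P (λ (x , y) → unpair∘pair x y))
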